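{- Let $m,n$ be relatively prime positive integers. A dominant affine permutation $w\in\widetilde{\mathfrak{S}}_n$ satisfies $w^{ -1}\in\mathcal{S}_m^n$ if and only if $[w(1),w(2),\ldots,w(n)]=n(\mathfrak{b})$ (as sorted lists) for some balanced $(m,n)$-filter $\mathfrak{b}$.
   Context: $\widetilde{\mathfrak{S}}_n$ is the group of bijections $w:\mathbb{Z}\to\mathbb{Z}$ with $w(i+n)=w(i)+n$ and $\sum_{i=1}^n w(i)=\binom{n+1}{2}$; $w$ is dominant if $w(1)<\cdots<w(n)$. $\mathcal{S}_m^n$ is the Sommers region, the region bounded by the $n$ affine hyperplanes of height $m$ in the affine $\widetilde{\mathfrak{S}}_n$ arrangement; $w^{ -1}\in\mathcal{S}_m^n$ means $w^{ -1}$ labels an alcove in it, equivalently (known characterization) $w(i)-w(j)\ne m$ for all integers $i<j$. The level of $(i,j)\in\mathbb{Z}^2$ is $\ell(i,j)=im+jn$. An $(m,n)$-filter is a nonempty proper upward-closed (componentwise order) subset $\mathfrak{i}\subsetneq\mathbb{Z}^2$ such that whenever $(i,j)\in\mathfrak{i}$ all points of the same level lie in $\mathfrak{i}$. $m(\mathfrak{i})$ is the set of $\min\{\ell(i,j):(i,j)\in\mathfrak{i}\}$ over $j\in\mathbb{Z}$ (minimum over $i$, $j$ fixed), $n(\mathfrak{i})$ the set of $\min\{\ell(i,j):(i,j)\in\mathfrak{i}\}$ over $i\in\mathbb{Z}$ (minimum over $j$, $i$ fixed). An $(m,n)$-filter $\mathfrak{b}$ is balanced if $\sum_{x\in m(\mathfrak{b})}x=\binom{m+1}{2}$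 and $\sum_{y\in n(\mathfrak{b})}y=\binom{n+1}{2}$. -}

module Defs where

open import Level using (Level; suc; zero)
open import Data.Nat as ℕ using (ℕ)
open import Data.Nat.Combinatorics using (_C_)
open import Data.Integer using (ℤ; +_; _+_; _-_; _*_; _<_; _≤_; 0ℤ)
open import Data.List using (List; map; upTo; foldr)
open import Data.List.Membership.Propositional using (_∈_)
open import Data.List.Relation.Unary.Unique.Propositional using (Unique)
open import Data.Product using (Σ; ∃; _×_; ∃-syntax)
open import Function.Bundles using (_⇔_)
open import Function.Definitions using (Bijective)
open import Relation.Binary.PropositionalEquality using (_≡_; _≢_)
open import Relation.Nullary using (¬_)

tri : ℕ → ℤ
tri k = + ((ℕ.suc k) C 2)

sumℤ : List ℤ → ℤ
sumℤ = foldr _+_ 0ℤ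

wList : ℕ → (ℤ → ℤ) → List ℤ
wList n w = map (λ k → w (+ (ℕ.suc k))) (upTo n)

record IsAffinePerm (n : ℕ) (w : ℤ → ℤ) : Set where
  field
    bij     : Bijective _≡_ _≡_ w
    periodic : ∀ i → w (i + + n) ≡ w i + + n
    sumCond : sumℤ (wList n w) ≡ tri n

Dominant : ℕ → (ℤ → ℤ) → Set
Dominant n w = ∀ k → ℕ.suc k ℕ.< n → w (+ (ℕ.suc k)) < w (+ (ℕ.suc (ℕ.suc k)))

-- w^{-1} ∈ S_m^n, via the known characterization from the context:
-- w(i) - w(j) ≠ m for all integers i < j
InverseInSommers : ℕ → (ℤ → ℤ) → Set
InverseInSommers m w = ∀ i j → i < j → w i - w j ≢ + m

level : ℕ → ℕ → ℤ → ℤ → ℤ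
level m n i j = i * + m + j * + n

Subset² : Set₁
Subset² = ℤ → ℤ → Set

record IsFilter (m n : ℕ) (𝔦 : Subset²) : Set where
  field
    nonempty : ∃[ i ] ∃[ j ] 𝔦 i j
    proper   : ∃[ i ] ∃[ j ] ¬ 𝔦 i j
    upward   : ∀ i j i' j' → 𝔦 i j → i ≤ i' → j ≤ j' → 𝔦 i' j'
    levelClosed : ∀ i j i' j' → 𝔦 i j → level m n i j ≡ level m n i' j' → 𝔦 i' j'

MinOverI : ℕ → ℕ → Subset² → ℤ → ℤ → Set
MinOverI m n 𝔦 j x =
  (∃[ i ] (𝔦 i j × level m n i j ≡ x)) × (∀ i → 𝔦 i j → x ≤ level m n i j)

MinOverJ : ℕ → ℕ → Subset² → ℤ → ℤ → Set
MinOverJ m n 𝔦 i x =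
  (∃[ j ] (𝔦 i j × level m n i j ≡ x)) × (∀ j → 𝔦 i j → x ≤ level m n i j)

mSet : ℕ → ℕ → Subset² → ℤ → Set
mSet m n 𝔦 x = ∃[ j ] MinOverI m n 𝔦 j x

nSet : ℕ → ℕ → Subset² → ℤ → Set
nSet m n 𝔦 x = ∃[ i ] MinOverJ m n 𝔦 i x

HasFiniteSum : (ℤ → Set) → ℤ → Set
HasFiniteSum S s = ∃[ l ] (Unique l × (∀ x → (x ∈ l) ⇔ S x) × sumℤ l ≡ s)

record IsBalanced (m n : ℕ) (𝔟 : Subset²) : Set where
  field
    filter : IsFilter m n 𝔟
    mSum   : HasFiniteSum (mSet m n 𝔟) (tri m)
    nSum   : HasFiniteSum (nSet m n 𝔟) (tri n)

-- For w⁻¹ ∈ 𝒮ₘⁿ let P = {x | w⁻¹ x ≥ 1}. Periodicity closes P under +n and the Sommers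
-- condition closes it under +m, so 𝔟 = {(i, j) | i m + j n ∈ P} is a filter. Every integer
-- is a level (Bézout), hence m(𝔟) and n(𝔟) are the sets of m- and n-generators of P
-- (x ∈ P with x - k ∉ P), and the n-generators are w(1), …, w(n). If [B, ∞) ⊆ P and
-- N = #(P ∩ (-∞, B)), the k-generators of P sum to k (B - N) + C(k, 2) for every k; the
-- normalisation Σ w(i) = C(n+1, 2) forces B - N = 1, so the m-generators sum to C(m+1, 2).
-- Conversely only the filter property of 𝔟 is needed: if w i - w j = m with i < j,
-- translate by a multiple of n so that 1 ≤ j ≤ n. Then w i = w j + m is a level of 𝔟, which
-- forces i ≥ 1 since each w(r) is minimal on its line, and dominance gives w i < w j.

module Submission where

open import Defs
open import Algebra.Bundles using (CommutativeMonoid)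
open import Data.Empty using (⊥-elim)
open import Data.Integer as ℤ using (ℤ; +_; -[1+_]; _+_; _-_; _*_; -_; 0ℤ; _≤_; _<_)
open import Data.Integer.DivMod using (_%ℕ_; _/ℕ_; a≡a%ℕn+[a/ℕn]*n; n%ℕd<d)
import Data.Integer.Properties as ℤP
open import Data.Integer.Tactic.RingSolver using (solve-∀)
open import Data.List using (List; applyUpTo)
import Data.List.Extrema as Extrema
open import Data.List.Membership.Propositional using (_∈_)
open import Data.List.Membership.Propositional.Properties
  using (∈-applyUpTo⁺; ∈-applyUpTo⁻; ∈-map⁺; ∈-map⁻; ∈-upTo⁺; ∈-upTo⁻)
open import Data.List.Membership.Propositional.Properties.WithK using (unique∧set⇒bag)
open import Data.List.Relation.Binary.BagAndSetEquality using (∼bag⇒↭)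
open import Data.List.Relation.Binary.Permutation.Propositional using (↭⇒↭ₛ)
open import Data.List.Relation.Binary.Permutation.Setoid.Properties using (foldr-commMonoid)
import Data.List.Relation.Unary.All as All
open import Data.List.Relation.Unary.Unique.Propositional using (Unique)
open import Data.List.Relation.Unary.Unique.Propositional.Properties using (applyUpTo⁺₁; map⁺; upTo⁺)
open import Data.Nat as ℕ using (ℕ; zero; suc; NonZero)
open import Data.Nat.Combinatorics using (_C_; nCk+nC[k+1]≡[n+1]C[k+1]; nC1≡n)
open import Data.Nat.Coprimality using (Coprime; coprime-Bézout)
open import Data.Nat.DivMod using (_%_; [m+kn]%n≡m%n; m<n⇒m%n≡m)
open import Data.Nat.GCD using (module Bézout)
import Data.Nat.Properties as ℕP
open import Data.Product using (Σ; ∃-syntax; _×_; _,_; proj₁; proj₂)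
open import Data.Sum using (_⊎_; inj₁; inj₂)
open import Function using (_∘_)
open import Function.Bundles using (_⇔_; mk⇔; Equivalence)
open import Function.Construct.Composition using (_⇔-∘_)
open import Function.Construct.Symmetry using (⇔-sym)
open import Relation.Binary.PropositionalEquality
  using (_≡_; refl; sym; trans; cong; cong₂; subst; module ≡-Reasoning)
open import Relation.Nullary using (¬_; yes; no)
open import Relation.Unary using (Decidable)
open import Algebra.Properties.CommutativeSemigroup ℕP.+-commutativeSemigroup
  using () renaming (interchange to +-interchange)

i-k<i : ∀ i k .{{_ : NonZero k}} → i - + k < i
i-k<i i k = subst (i - + k <_) (ℤP.+-identityʳ i)
  (ℤP.+-monoʳ-< i (ℤP.neg-mono-< (ℤ.+<+ (ℕ.>-nonZero⁻¹ k))))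

≤⇒≡+ : ∀ {i j} → i ≤ j → ∃[ d ] j ≡ i + + d
≤⇒≡+ {i} {j} i≤j = ℤ.∣ j - i ∣ , (begin
  j                  ≡⟨ j≡i+[j-i] i j ⟩
  i + (j - i)        ≡⟨ cong (λ d → i + d) (ℤP.0≤i⇒+∣i∣≡i (ℤP.i≤j⇒0≤j-i i≤j)) ⟨
  i + + ℤ.∣ j - i ∣ ∎)
  where
  open ≡-Reasoning
  j≡i+[j-i] : ∀ i j → j ≡ i + (j - i)
  j≡i+[j-i] = solve-∀

i≤i+an : ∀ i a n → i ≤ i + + a * + n
i≤i+an i a n = subst (λ y → i ≤ i + y) (ℤP.pos-* a n) (ℤP.i≤i+j i (+ (a ℕ.* n)))

i+[-1-a]n<i : ∀ i a n .{{_ : NonZero n}} → i + -[1+ a ] * + n < i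
i+[-1-a]n<i i a n = subst (_< i) (begin
    i - + (suc a ℕ.* n)          ≡⟨ cong (λ y → i - y) (ℤP.pos-* (suc a) n) ⟩
    i - + suc a * + n            ≡⟨ regroup i (+ suc a) (+ n) ⟩
    i + -[1+ a ] * + n           ∎)
  (i-k<i i (suc a ℕ.* n) {{ℕP.m*n≢0 (suc a) n}})
  where
  open ≡-Reasoning
  regroup : ∀ i s n → i - s * n ≡ i + - s * n
  regroup = solve-∀

1≤1+r+an : ∀ r a n → + 1 ≤ + suc r + + a * + n
1≤1+r+an r a n = subst (λ y → + 1 ≤ + suc r + y) (ℤP.pos-* a n)
  (ℤ.+≤+ (ℕ.s≤s ℕ.z≤n))

1+r-[1+a]n<1 : ∀ {r n} a → r ℕ.< n → + suc r + -[1+ a ] * + n < + 1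
1+r-[1+a]n<1 {r} {n} a r<n = ℤP.≤-<-trans (ℤP.+-monoˡ-≤ (-[1+ a ] * + n) (ℤ.+≤+ r<n))
  (subst (_< + 1) n-[1+a]n≡ (ℤP.≤-<-trans ℤP.neg-≤-pos (ℤ.+<+ ℕ.z<s)))
  where
  regroup : ∀ a n → - (a * n) ≡ n + - (+ 1 + a) * n
  regroup = solve-∀
  n-[1+a]n≡ : - + (a ℕ.* n) ≡ + n + -[1+ a ] * + n
  n-[1+a]n≡ = trans (cong -_ (ℤP.pos-* a n)) (regroup (+ a) (+ n))

1≤t<1+s⇒t≡1+r : ∀ {t s} → + 1 ≤ t → t < + suc s → ∃[ r ] r ℕ.< s × t ≡ + suc r
1≤t<1+s⇒t≡1+r 1≤t t<1+s with ≤⇒≡+ 1≤t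
... | d , refl = d , ℕP.≤-pred (ℤP.drop‿+<+ t<1+s) , refl

B+r-[1+F]k<B-Fk : ∀ B F {r k} → r ℕ.< k → B + + r - + (suc F ℕ.* k) < B - + (F ℕ.* k)
B+r-[1+F]k<B-Fk B F {r} {k} r<k = subst (B + + r - + (suc F ℕ.* k) <_) B+k-[k+Fk]≡
  (ℤP.+-monoˡ-< (- + (suc F ℕ.* k)) (ℤP.+-monoʳ-< B (ℤ.+<+ r<k)))
  where
  regroup : ∀ B k Fk → B + k - (k + Fk) ≡ B - Fk
  regroup = solve-∀
  B+k-[k+Fk]≡ : B + + k - + (suc F ℕ.* k) ≡ B - + (F ℕ.* k)
  B+k-[k+Fk]≡ = trans (cong (λ x → B + + k - x) (ℤP.pos-+ k (F ℕ.* k))) (regroup B (+ k) (+ (F ℕ.* k)))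

residue-injective : ∀ {i j k a b} .{{_ : NonZero k}} → i ℕ.< k → j ℕ.< k →
                    i ℕ.+ a ℕ.* k ≡ j ℕ.+ b ℕ.* k → i ≡ j
residue-injective {i} {j} {k} {a} {b} i<k j<k eq = begin
  i                      ≡⟨ m<n⇒m%n≡m i<k ⟨
  i % k                  ≡⟨ [m+kn]%n≡m%n i a k ⟨
  (i ℕ.+ a ℕ.* k) % k    ≡⟨ cong (_% k) eq ⟩
  (j ℕ.+ b ℕ.* k) % k    ≡⟨ [m+kn]%n≡m%n j b k ⟩
  j % k                  ≡⟨ m<n⇒m%n≡m j<k ⟩
  j                      ∎
  where open ≡-Reasoning

divMod-from-1 : ∀ n .{{_ : NonZero n}} t → ∃[ r ] r ℕ.< n × ∃[ q ] t ≡ + suc r + q * + n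
divMod-from-1 n t = r , n%ℕd<d (t - + 1) n , q , (begin
  t                        ≡⟨ t≡1+[t-1] t ⟩
  + 1 + (t - + 1)          ≡⟨ cong (λ y → + 1 + y) (a≡a%ℕn+[a/ℕn]*n (t - + 1) n) ⟩
  + 1 + (+ r + q * + n)    ≡⟨ ℤP.+-assoc (+ 1) (+ r) (q * + n) ⟨
  + 1 + + r + q * + n      ≡⟨ cong (λ y → y + q * + n) (ℤP.pos-+ 1 r) ⟨
  + suc r + q * + n        ∎)
  where
  open ≡-Reasoning
  r : ℕ
  r = (t - + 1) %ℕ n
  q : ℤ
  q = (t - + 1) /ℕ n
  t≡1+[t-1] : ∀ t → t ≡ + 1 + (t - + 1)
  t≡1+[t-1] = solve-∀

affine-cancel : ∀ k .{{_ : NonZero k}} {x y c} → + k * x + c ≡ + k * y + c → x ≡ y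
affine-cancel k {x} {y} {c} eq = ℤP.*-cancelˡ-≡ (+ k) x y
  (trans (sym (add-sub (+ k * x) c)) (trans (cong (λ z → z - c) eq) (add-sub (+ k * y) c)))
  where
  add-sub : ∀ a c → a + c - c ≡ a
  add-sub = solve-∀

∑< : ℕ → (ℕ → ℕ) → ℕ
∑< zero    f = 0
∑< (suc l) f = f 0 ℕ.+ ∑< l (f ∘ suc)

syntax ∑< l (λ t → e) = ∑[ t < l ] e

∑-cong : ∀ l {f g} → (∀ t → f t ≡ g t) → ∑< l f ≡ ∑< l g
∑-cong zero    f≗g = refl
∑-cong (suc l) f≗g = cong₂ ℕ._+_ (f≗g 0) (∑-cong l (f≗g ∘ suc))

∑-zero : ∀ l → ∑[ t < l ] 0 ≡ 0
∑-zero zero    = refl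
∑-zero (suc l) = ∑-zero l

∑-distrib-+ : ∀ l f g → ∑[ t < l ] (f t ℕ.+ g t) ≡ ∑< l f ℕ.+ ∑< l g
∑-distrib-+ zero    f g = refl
∑-distrib-+ (suc l) f g = trans (cong (f 0 ℕ.+ g 0 ℕ.+_) (∑-distrib-+ l (f ∘ suc) (g ∘ suc)))
                                (+-interchange (f 0) (g 0) _ _)

∑-split : ∀ a b f → ∑< (a ℕ.+ b) f ≡ ∑< a f ℕ.+ ∑[ t < b ] f (a ℕ.+ t)
∑-split zero    b f = refl
∑-split (suc a) b f = trans (cong (f 0 ℕ.+_) (∑-split a b (f ∘ suc))) (sym (ℕP.+-assoc (f 0) _ _))

∑-distribʳ-* : ∀ l f k → ∑[ t < l ] (f t ℕ.* k) ≡ ∑< l f ℕ.* k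
∑-distribʳ-* zero    f k = refl
∑-distribʳ-* (suc l) f k = trans (cong (f 0 ℕ.* k ℕ.+_) (∑-distribʳ-* l (f ∘ suc) k))
                                 (sym (ℕP.*-distribʳ-+ k (f 0) _))

C2-suc : ∀ l → suc l C 2 ≡ l ℕ.+ l C 2
C2-suc l = trans (sym (nCk+nC[k+1]≡[n+1]C[k+1] l 1)) (cong (ℕ._+ l C 2) (nC1≡n l))

tri-unfold : ∀ k → tri k ≡ + k * + 1 + + (k C 2)
tri-unfold k = trans (cong +_ (C2-suc k))
  (trans (ℤP.pos-+ k _) (cong (_+ + (k C 2)) (sym (ℤP.*-identityʳ (+ k)))))

sumℤ-applyUpTo-affine : ∀ l B c {f} → (∀ t → f t ≡ B + + t - + c t) →
                        sumℤ (applyUpTo f l) ≡ + l * B + + (l C 2) - + ∑< l c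
sumℤ-applyUpTo-affine zero    B c f≗ = refl
sumℤ-applyUpTo-affine (suc l) B c {f} f≗ = begin
  f 0 + sumℤ (applyUpTo (f ∘ suc) l)
    ≡⟨ cong₂ _+_ (f≗ 0) (sumℤ-applyUpTo-affine l (B + + 1) (c ∘ suc) f∘suc≗) ⟩
  B + + 0 - + c 0 + (+ l * (B + + 1) + + (l C 2) - + ∑< l (c ∘ suc))
    ≡⟨ regroup B (+ l) (+ (l C 2)) (+ c 0) (+ ∑< l (c ∘ suc)) ⟩
  (+ 1 + + l) * B + (+ l + + (l C 2)) - (+ c 0 + + ∑< l (c ∘ suc))
    ≡⟨ cong (λ x → x * B + (+ l + + (l C 2)) - (+ c 0 + + ∑< l (c ∘ suc))) (ℤP.pos-+ 1 l) ⟨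
  + suc l * B + (+ l + + (l C 2)) - (+ c 0 + + ∑< l (c ∘ suc))
    ≡⟨ cong₂ (λ y z → + suc l * B + y - z) (trans (cong +_ (C2-suc l)) (ℤP.pos-+ l _))
                                            (ℤP.pos-+ (c 0) _) ⟨
  + suc l * B + + (suc l C 2) - + ∑< (suc l) c ∎
  where
  open ≡-Reasoning
  shift : ∀ B t c → B + (+ 1 + t) - c ≡ B + + 1 + t - c
  shift = solve-∀
  f∘suc≗ : ∀ t → f (suc t) ≡ B + + 1 + + t - + c (suc t)
  f∘suc≗ t = trans (f≗ (suc t))
    (trans (cong (λ x → B + x - + c (suc t)) (ℤP.pos-+ 1 t)) (shift B (+ t) _))
  regroup : ∀ B l L c C → B + + 0 - c + (l * (B + + 1) + L - C) ≡ (+ 1 + l) * B + (l + L) - (c + C)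
  regroup = solve-∀

unique∧set⇒sumℤ≡ : ∀ {xs ys} → Unique xs → Unique ys → (∀ x → x ∈ xs ⇔ x ∈ ys) →
                   sumℤ xs ≡ sumℤ ys
unique∧set⇒sumℤ≡ xs! ys! xs≈ys = foldr-commMonoid setoid isCommutativeMonoid
  (↭⇒↭ₛ (∼bag⇒↭ (unique∧set⇒bag xs! ys! (λ {x} → xs≈ys x))))
  where open CommutativeMonoid ℤP.+-0-commutativeMonoid

windowSum : (ℤ → ℕ) → ℤ → ℕ → ℕ
windowSum f x l = ∑[ t < l ] f (x + + t)

windowSum-split : ∀ f x a b → windowSum f x (a ℕ.+ b) ≡ windowSum f x a ℕ.+ windowSum f (x + + a) b
windowSum-split f x a b = trans (∑-split a b _) (cong (windowSum f x a ℕ.+_) (∑-cong b shift))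
  where
  shift : ∀ t → f (x + + (a ℕ.+ t)) ≡ f (x + + a + + t)
  shift t = cong f (trans (cong (λ d → x + d) (ℤP.pos-+ a t)) (sym (ℤP.+-assoc x (+ a) (+ t))))

module Strides (f : ℤ → ℕ) (k : ℕ) where

  strideSum : ℕ → ℤ → ℕ
  strideSum zero    y = 0
  strideSum (suc F) y = f (y - + k) ℕ.+ strideSum F (y - + k)

  -- The points y + r - t k with r < k and 1 ≤ t ≤ F tile the window [y - F k, y).
  ∑-strideSum : ∀ F y → ∑[ r < k ] strideSum F (y + + r) ≡ windowSum f (y - + (F ℕ.* k)) (F ℕ.* k)
  ∑-strideSum zero    y = ∑-zero k
  ∑-strideSum (suc F) y = begin
    ∑[ r < k ] (f (y + + r - + k) ℕ.+ strideSum F (y + + r - + k))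
      ≡⟨ ∑-cong k (λ r → cong (λ x → f x ℕ.+ strideSum F x) (swap y (+ r) (+ k))) ⟩
    ∑[ r < k ] (f (y - + k + + r) ℕ.+ strideSum F (y - + k + + r))
      ≡⟨ ∑-distrib-+ k _ _ ⟩
    windowSum f (y - + k) k ℕ.+ ∑[ r < k ] strideSum F (y - + k + + r)
      ≡⟨ cong (windowSum f (y - + k) k ℕ.+_) (∑-strideSum F (y - + k)) ⟩
    windowSum f (y - + k) k ℕ.+ windowSum f (y - + k - + Fk) Fk
      ≡⟨ ℕP.+-comm (windowSum f (y - + k) k) _ ⟩
    windowSum f (y - + k - + Fk) Fk ℕ.+ windowSum f (y - + k) k
      ≡⟨ cong₂ (λ a b → windowSum f a Fk ℕ.+ windowSum f b k) start top ⟩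
    windowSum f z Fk ℕ.+ windowSum f (z + + Fk) k
      ≡⟨ windowSum-split f z Fk k ⟨
    windowSum f z (Fk ℕ.+ k)
      ≡⟨ cong (windowSum f z) (ℕP.+-comm Fk k) ⟩
    windowSum f z (k ℕ.+ Fk) ∎
    where
    open ≡-Reasoning
    Fk : ℕ
    Fk = F ℕ.* k
    z : ℤ
    z = y - + (k ℕ.+ Fk)
    swap : ∀ y r k → y + r - k ≡ y - k + r
    swap = solve-∀
    start : y - + k - + Fk ≡ z
    start = trans (lemma y (+ k) (+ Fk)) (cong (λ d → y - d) (sym (ℤP.pos-+ k Fk)))
      where
      lemma : ∀ y k d → y - k - d ≡ y - (k + d)
      lemma = solve-∀
    top : y - + k ≡ z + + Fk
    top = trans (lemma y (+ k) (+ Fk)) (cong (λ d → y - d + + Fk) (sym (ℤP.pos-+ k Fk)))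
      where
      lemma : ∀ y k d → y - k ≡ y - (k + d) + d
      lemma = solve-∀

indicator : {P : ℤ → Set} → Decidable P → ℤ → ℕ
indicator P? x with P? x
... | yes _ = 1
... | no  _ = 0

module Generators {P : ℤ → Set} (P? : Decidable P) (k : ℕ) .{{_ : NonZero k}}
                  (P-+k : ∀ x → P x → P (x + + k)) where

  IsGenerator : ℤ → Set
  IsGenerator x = P x × ¬ P (x - + k)

  P-+*k : ∀ a x → P x → P (x + + a * + k)
  P-+*k zero    x Px = subst P (x≡x+0*k x (+ k)) Px
    where
    x≡x+0*k : ∀ x k → x ≡ x + + 0 * k
    x≡x+0*k = solve-∀
  P-+*k (suc a) x Px = subst P (trans (regroup x (+ a) (+ k)) (cong (λ c → x + c * + k) (sym (ℤP.pos-+ 1 a))))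
                               (P-+*k a (x + + k) (P-+k x Px))
    where
    regroup : ∀ x a k → x + k + a * k ≡ x + (+ 1 + a) * k
    regroup = solve-∀

  ¬P⇒¬P[x-k] : ∀ x → ¬ P x → ¬ P (x - + k)
  ¬P⇒¬P[x-k] x ¬Px Px-k = ¬Px (subst P (x-k+k≡x x (+ k)) (P-+k _ Px-k))
    where
    x-k+k≡x : ∀ x k → x - k + k ≡ x
    x-k+k≡x = solve-∀

  generator-unique : ∀ {g g'} e → IsGenerator g → IsGenerator g' → g ≡ g' + e * + k → g ≡ g'
  generator-unique {g} {g'} (+ zero) _ _ g≡ = trans g≡ (x+0*k≡x g' (+ k))
    where
    x+0*k≡x : ∀ x k → x + + 0 * k ≡ x
    x+0*k≡x = solve-∀
  generator-unique {g} {g'} (+ suc a) (_ , ¬Pg-k) (Pg' , _) g≡ =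
    ⊥-elim (¬Pg-k (subst P (sym g-k≡) (P-+*k a g' Pg')))
    where
    regroup : ∀ g a k → g + (+ 1 + a) * k - k ≡ g + a * k
    regroup = solve-∀
    g-k≡ : g - + k ≡ g' + + a * + k
    g-k≡ = trans (cong (λ x → x - + k) (trans g≡ (cong (λ c → g' + c * + k) (ℤP.pos-+ 1 a))))
                 (regroup g' (+ a) (+ k))
  generator-unique {g} {g'} -[1+ a ] (Pg , _) (_ , ¬Pg'-k) g≡ =
    ⊥-elim (¬Pg'-k (subst P (sym g'-k≡) (P-+*k a g Pg)))
    where
    regroup : ∀ g' a k → g' - k ≡ g' + - (+ 1 + a) * k + a * k
    regroup = solve-∀
    g'-k≡ : g' - + k ≡ g + + a * + k
    g'-k≡ = trans (regroup g' (+ a) (+ k))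
                  (cong (λ x → x + + a * + k) (sym (trans g≡ (cong (λ c → g' + - c * + k) (ℤP.pos-+ 1 a)))))

  open Strides (indicator P?) k public

  strideSum-¬P : ∀ F y → ¬ P y → strideSum F y ≡ 0
  strideSum-¬P zero    y ¬Py = refl
  strideSum-¬P (suc F) y ¬Py with P? (y - + k)
  ... | yes Py-k = ⊥-elim (¬P⇒¬P[x-k] y ¬Py Py-k)
  ... | no ¬Py-k = strideSum-¬P F (y - + k) ¬Py-k

  -- As P is closed under +k, its points among y - k, …, y - F k form an initial segment, so
  -- for y ∈ P this is the least point of P in y - k ℕ once y - (F + 1) k ∉ P.
  generatorOf : ℕ → ℤ → ℤ
  generatorOf F y = y - + (strideSum F y ℕ.* k)

  generatorOf-isGenerator : ∀ F y → P y → ¬ P (y - + (suc F ℕ.* k)) → IsGenerator (generatorOf F y)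
  generatorOf-isGenerator zero y Py ¬Py-k =
    subst IsGenerator (sym (ℤP.+-identityʳ y)) (Py , subst (λ c → ¬ P (y - + c)) (ℕP.+-identityʳ k) ¬Py-k)
  generatorOf-isGenerator (suc F) y Py ¬Py-FFk with P? (y - + k)
  ... | yes Py-k = subst IsGenerator (sym step)
        (generatorOf-isGenerator F (y - + k) Py-k (subst (λ x → ¬ P x) (sym deeper) ¬Py-FFk))
    where
    regroup : ∀ y k d → y - (k + d) ≡ y - k - d
    regroup = solve-∀
    step : y - + (k ℕ.+ strideSum F (y - + k) ℕ.* k) ≡ y - + k - + (strideSum F (y - + k) ℕ.* k)
    step = trans (cong (λ d → y - d) (ℤP.pos-+ k _)) (regroup y (+ k) _)
    deeper : y - + k - + (suc F ℕ.* k) ≡ y - + (suc (suc F) ℕ.* k)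
    deeper = trans (sym (regroup y (+ k) _)) (cong (λ d → y - d) (sym (ℤP.pos-+ k _)))
  ... | no ¬Py-k = subst IsGenerator (sym (trans (cong (λ c → y - + (c ℕ.* k)) (strideSum-¬P F _ ¬Py-k))
                                              (ℤP.+-identityʳ y)))
                         (Py , ¬Py-k)

  module OnLine (line : ℤ → ℤ) (line-+ : ∀ j e → line (j + e) ≡ line j + e * + k) where

    MinOnLine : ℤ → Set
    MinOnLine x = (∃[ j ] (P (line j) × line j ≡ x)) × (∀ j → P (line j) → x ≤ line j)

    minOnLine⇒isGenerator : ∀ {x} → MinOnLine x → IsGenerator x
    minOnLine⇒isGenerator {x} ((j , Pℓj , ℓj≡x) , minimal) = subst P ℓj≡x Pℓj , λ Px-k →
      ℤP.<⇒≱ (i-k<i x k) (subst (x ≤_) ℓ[j-1]≡ (minimal (j + ℤ.-1ℤ) (subst P (sym ℓ[j-1]≡) Px-k)))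
      where
      x-1*k : ∀ x k → x + ℤ.-1ℤ * k ≡ x - k
      x-1*k = solve-∀
      ℓ[j-1]≡ : line (j + ℤ.-1ℤ) ≡ x - + k
      ℓ[j-1]≡ = trans (line-+ j ℤ.-1ℤ) (trans (cong (λ y → y + ℤ.-1ℤ * + k) ℓj≡x) (x-1*k x (+ k)))

    isGenerator⇒minOnLine : ∀ {x} j → line j ≡ x → IsGenerator x → MinOnLine x
    isGenerator⇒minOnLine {x} j ℓj≡x (Px , ¬Px-k) = (j , subst P (sym ℓj≡x) Px , ℓj≡x) , minimal
      where
      above : ∀ e → P (x + e * + k) → x ≤ x + e * + k
      above (+ a)      _  = i≤i+an x a k
      above -[1+ a ] Px-ek = ⊥-elim (¬Px-k (subst P (regroup x (+ a) (+ k)) (P-+*k a _ Px-ek)))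
        where
        regroup : ∀ x a k → x + - (+ 1 + a) * k + a * k ≡ x - k
        regroup = solve-∀

      minimal : ∀ j' → P (line j') → x ≤ line j'
      minimal j' Pℓj' = subst (x ≤_) (sym ℓj'≡) (above (j' - j) (subst P ℓj'≡ Pℓj'))
        where
        j'≡ : ∀ j j' → j' ≡ j + (j' - j)
        j'≡ = solve-∀
        ℓj'≡ : line j' ≡ x + (j' - j) * + k
        ℓj'≡ = trans (cong line (j'≡ j j')) (trans (line-+ j _) (cong (λ y → y + (j' - j) * + k) ℓj≡x))

  module Bounded (L B : ℤ) (¬P-below : ∀ x → x < L → ¬ P x) (P-above : ∀ x → B ≤ x → P x)
                 (F : ℕ) (B-Fk≤L : B - + (F ℕ.* k) ≤ L) where

    generator : ℕ → ℤ
    generator r = generatorOf F (B + + r)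

    generators : List ℤ
    generators = applyUpTo generator k

    generator-isGenerator : ∀ {r} → r ℕ.< k → IsGenerator (generator r)
    generator-isGenerator {r} r<k = generatorOf-isGenerator F (B + + r) (P-above _ (ℤP.i≤i+j B (+ r)))
      (¬P-below _ (ℤP.<-≤-trans (B+r-[1+F]k<B-Fk B F r<k) B-Fk≤L))

    ∈-generators⇔ : ∀ x → x ∈ generators ⇔ IsGenerator x
    ∈-generators⇔ x = mk⇔ ∈⇒ ⇒∈
      where
      ∈⇒ : x ∈ generators → IsGenerator x
      ∈⇒ x∈ with ∈-applyUpTo⁻ generator x∈
      ... | r , r<k , refl = generator-isGenerator r<k
      ⇒∈ : IsGenerator x → x ∈ generators
      ⇒∈ isGen = subst (_∈ generators) (sym x≡) (∈-applyUpTo⁺ generator r<k)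
        where
        r : ℕ
        r = (x - B) %ℕ k
        q : ℤ
        q = (x - B) /ℕ k
        r<k : r ℕ.< k
        r<k = n%ℕd<d (x - B) k
        s : ℕ
        s = strideSum F (B + + r)
        x≡ : x ≡ generator r
        x≡ = generator-unique (q + + s) isGen (generator-isGenerator r<k) (begin
          x                                   ≡⟨ x≡B+[x-B] x B ⟩
          B + (x - B)                         ≡⟨ cong (λ y → B + y) (a≡a%ℕn+[a/ℕn]*n (x - B) k) ⟩
          B + (+ r + q * + k)                 ≡⟨ regroup B (+ r) q (+ s) (+ k) ⟩
          B + + r - + s * + k + (q + + s) * + k ≡⟨ cong (λ y → B + + r - y + (q + + s) * + k) (ℤP.pos-* s k) ⟨
          generator r + (q + + s) * + k       ∎)
          where
          open ≡-Reasoning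
          x≡B+[x-B] : ∀ x B → x ≡ B + (x - B)
          x≡B+[x-B] = solve-∀
          regroup : ∀ B r q s k → B + (r + q * k) ≡ B + r - s * k + (q + s) * k
          regroup = solve-∀

    generator-injective : ∀ {i j} → i ℕ.< k → j ℕ.< k → generator i ≡ generator j → i ≡ j
    generator-injective {i} {j} i<k j<k gi≡gj =
      residue-injective {a = sⱼ} {b = sᵢ} i<k j<k (ℤP.+-injective (begin
      + (i ℕ.+ sⱼ ℕ.* k)       ≡⟨ ℤP.pos-+ i _ ⟩
      + i + + (sⱼ ℕ.* k)       ≡⟨ cancel-B B (+ i) (+ j) _ _ gi≡gj ⟩
      + j + + (sᵢ ℕ.* k)       ≡⟨ ℤP.pos-+ j _ ⟨
      + (j ℕ.+ sᵢ ℕ.* k)       ∎))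
      where
      open ≡-Reasoning
      sᵢ : ℕ
      sᵢ = strideSum F (B + + i)
      sⱼ : ℕ
      sⱼ = strideSum F (B + + j)
      cancel-B : ∀ B i j a b → B + i - a ≡ B + j - b → i + b ≡ j + a
      cancel-B B i j a b eq = trans (l₁ B i j a b) (trans (cong (λ y → y + (a + b - B)) eq) (l₂ B i j a b))
        where
        l₁ : ∀ B i j a b → i + b ≡ B + i - a + (a + b - B)
        l₁ = solve-∀
        l₂ : ∀ B i j a b → B + j - b + (a + b - B) ≡ j + a
        l₂ = solve-∀

    generators-unique : Unique generators
    generators-unique = applyUpTo⁺₁ generator k λ i<j j<k gi≡gj →
      ℕP.<-irrefl (generator-injective (ℕP.<-trans i<j j<k) j<k gi≡gj) i<j

    sum-generators : sumℤ generators ≡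
                     + k * (B - + windowSum (indicator P?) (B - + (F ℕ.* k)) (F ℕ.* k)) + + (k C 2)
    sum-generators = begin
      sumℤ generators
        ≡⟨ sumℤ-applyUpTo-affine k B (λ r → strideSum F (B + + r) ℕ.* k) (λ _ → refl) ⟩
      + k * B + + (k C 2) - + ∑[ r < k ] (strideSum F (B + + r) ℕ.* k)
        ≡⟨ cong (λ c → + k * B + + (k C 2) - + c)
                (trans (∑-distribʳ-* k _ k) (cong (ℕ._* k) (∑-strideSum F B))) ⟩
      + k * B + + (k C 2) - + (N ℕ.* k)
        ≡⟨ cong (λ c → + k * B + + (k C 2) - c) (ℤP.pos-* N k) ⟩
      + k * B + + (k C 2) - + N * + k
        ≡⟨ regroup (+ k) B (+ (k C 2)) (+ N) ⟩
      + k * (B - + N) + + (k C 2) ∎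
      where
      open ≡-Reasoning
      N : ℕ
      N = windowSum (indicator P?) (B - + (F ℕ.* k)) (F ℕ.* k)
      regroup : ∀ k B C N → k * B + C - N * k ≡ k * (B - N) + C
      regroup = solve-∀

1+ab≡cd⇒ℤ : ∀ a b c d → 1 ℕ.+ a ℕ.* b ≡ c ℕ.* d → + 1 + + a * + b ≡ + c * + d
1+ab≡cd⇒ℤ a b c d eq = begin
  + 1 + + a * + b     ≡⟨ cong (λ z → + 1 + z) (ℤP.pos-* a b) ⟨
  + (1 ℕ.+ a ℕ.* b)   ≡⟨ cong +_ eq ⟩
  + (c ℕ.* d)         ≡⟨ ℤP.pos-* c d ⟩
  + c * + d           ∎
  where open ≡-Reasoning

bézout-ℤ : ∀ {m n} → Coprime m n → ∃[ u ] ∃[ v ] u * + m + v * + n ≡ + 1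
bézout-ℤ {m} {n} cop with coprime-Bézout cop
... | Bézout.+- x y eq = + x , - + y ,
  trans (cong (λ z → z + - + y * + n) (sym (1+ab≡cd⇒ℤ y n x m eq))) (cancel (+ y) (+ n))
  where
  cancel : ∀ y n → + 1 + y * n + - y * n ≡ + 1
  cancel = solve-∀
... | Bézout.-+ x y eq = - + x , + y ,
  trans (cong (λ z → - + x * + m + z) (sym (1+ab≡cd⇒ℤ x m y n eq))) (cancel (+ x) (+ m))
  where
  cancel : ∀ x m → - x * m + (+ 1 + x * m) ≡ + 1
  cancel = solve-∀

coprime⇒level-surjective : ∀ {m n} → Coprime m n → ∀ x → ∃[ i ] ∃[ j ] level m n i j ≡ x
coprime⇒level-surjective {m} {n} cop x with bézout-ℤ cop
... | u , v , um+vn≡1 = x * u , x * v , trans (regroup x u v (+ m) (+ n))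
                                           (trans (cong (x *_) um+vn≡1) (ℤP.*-identityʳ x))
  where
  regroup : ∀ x u v m n → x * u * m + x * v * n ≡ x * (u * m + v * n)
  regroup = solve-∀

level-+ʲ : ∀ m n i j e → level m n i (j + e) ≡ level m n i j + e * + n
level-+ʲ m n i j e = regroup i j e (+ m) (+ n)
  where
  regroup : ∀ i j e m n → i * m + (j + e) * n ≡ i * m + j * n + e * n
  regroup = solve-∀

level-+ⁱ : ∀ m n i j e → level m n (i + e) j ≡ level m n i j + e * + m
level-+ⁱ m n i j e = regroup i j e (+ m) (+ n)
  where
  regroup : ∀ i j e m n → (i + e) * m + j * n ≡ i * m + j * n + e * m
  regroup = solve-∀

module LevelFilter (m n : ℕ) .{{_ : NonZero m}} .{{_ : NonZero n}} {P : ℤ → Set} (P? : Decidable P)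
                   (P-+m : ∀ x → P x → P (x + + m)) (P-+n : ∀ x → P x → P (x + + n)) where

  levelSet : Subset²
  levelSet i j = P (level m n i j)

  module Gᵐ = Generators P? m P-+m
  module Gⁿ = Generators P? n P-+n

  mSet⇒isGenerator : ∀ {x} → mSet m n levelSet x → Gᵐ.IsGenerator x
  mSet⇒isGenerator (j , min) = OnLine.minOnLine⇒isGenerator (λ i → level m n i j) (λ i → level-+ⁱ m n i j) min
    where open Gᵐ

  nSet⇒isGenerator : ∀ {x} → nSet m n levelSet x → Gⁿ.IsGenerator x
  nSet⇒isGenerator (i , min) = OnLine.minOnLine⇒isGenerator (level m n i) (level-+ʲ m n i) min
    where open Gⁿ

  module _ (surjective : ∀ x → ∃[ i ] ∃[ j ] level m n i j ≡ x) where

    isGenerator⇒mSet : ∀ {x} → Gᵐ.IsGenerator x → mSet m n levelSet x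
    isGenerator⇒mSet {x} gen with surjective x
    ... | i , j , ℓ≡x = j , OnLine.isGenerator⇒minOnLine (λ i → level m n i j) (λ i → level-+ⁱ m n i j) i ℓ≡x gen
      where open Gᵐ

    isGenerator⇒nSet : ∀ {x} → Gⁿ.IsGenerator x → nSet m n levelSet x
    isGenerator⇒nSet {x} gen with surjective x
    ... | i , j , ℓ≡x = i , OnLine.isGenerator⇒minOnLine (level m n i) (level-+ʲ m n i) j ℓ≡x gen
      where open Gⁿ

    levelSet-isFilter : ∀ {x y} → P x → ¬ P y → IsFilter m n levelSet
    levelSet-isFilter {x} {y} Px ¬Py = record
      { nonempty    = let (i , j , ℓ≡x) = surjective x in i , j , subst P (sym ℓ≡x) Px
      ; proper      = let (i , j , ℓ≡y) = surjective y in i , j , λ Pℓ → ¬Py (subst P ℓ≡y Pℓ)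
      ; upward      = upward
      ; levelClosed = λ _ _ _ _ Pℓ ℓ≡ℓ' → subst P ℓ≡ℓ' Pℓ
      }
      where
      upward : ∀ i j i' j' → levelSet i j → i ≤ i' → j ≤ j' → levelSet i' j'
      upward i j i' j' Pℓ i≤i' j≤j' with ≤⇒≡+ i≤i' | ≤⇒≡+ j≤j'
      ... | a , refl | c , refl = subst P (sym (regroup i j (+ a) (+ c) (+ m) (+ n)))
                                        (Gⁿ.P-+*k c _ (Gᵐ.P-+*k a _ Pℓ))
        where
        regroup : ∀ i j a c m n → (i + a) * m + (j + c) * n ≡ i * m + j * n + a * m + c * n
        regroup = solve-∀

periodic-* : ∀ {n} {f : ℤ → ℤ} → (∀ i → f (i + + n) ≡ f i + + n) →
             ∀ i q → f (i + q * + n) ≡ f i + q * + n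
periodic-* {n} {f} f-+n = λ i → λ { (+ a) → +* i a ; -[1+ a ] → -* i a }
  where
  open ≡-Reasoning
  +* : ∀ i a → f (i + + a * + n) ≡ f i + + a * + n
  +* i zero    = trans (cong f (x+0*n≡x i (+ n))) (sym (x+0*n≡x (f i) (+ n)))
    where
    x+0*n≡x : ∀ x n → x + + 0 * n ≡ x
    x+0*n≡x = solve-∀
  +* i (suc a) = begin
    f (i + + suc a * + n)     ≡⟨ cong f (unfold i a) ⟩
    f (i + + n + + a * + n)   ≡⟨ +* (i + + n) a ⟩
    f (i + + n) + + a * + n   ≡⟨ cong (λ y → y + + a * + n) (f-+n i) ⟩
    f i + + n + + a * + n     ≡⟨ unfold (f i) a ⟨
    f i + + suc a * + n       ∎
    where
    regroup : ∀ i a n → i + (+ 1 + a) * n ≡ i + n + a * n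
    regroup = solve-∀
    unfold : ∀ x a → x + + suc a * + n ≡ x + + n + + a * + n
    unfold x a = trans (cong (λ c → x + c * + n) (ℤP.pos-+ 1 a)) (regroup x (+ a) (+ n))
  -* : ∀ i a → f (i + -[1+ a ] * + n) ≡ f i + -[1+ a ] * + n
  -* i a = begin
    f i'                                  ≡⟨ x+c-c≡x (f i') c ⟨
    f i' + c - c                          ≡⟨ cong (λ y → y - c) (+* i' (suc a)) ⟨
    f (i' + c) - c                        ≡⟨ cong (λ y → f y - c) (x-c+c≡x i (+ suc a) (+ n)) ⟩
    f i - c                               ≡⟨ x-c≡ (f i) (+ suc a) (+ n) ⟩
    f i + -[1+ a ] * + n                  ∎
    where
    i' : ℤ
    i' = i + -[1+ a ] * + n
    c : ℤ
    c = + suc a * + n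
    x+c-c≡x : ∀ x c → x + c - c ≡ x
    x+c-c≡x = solve-∀
    x-c+c≡x : ∀ x s n → x + - s * n + s * n ≡ x
    x-c+c≡x = solve-∀
    x-c≡ : ∀ x s n → x - s * n ≡ x + - s * n
    x-c≡ = solve-∀

module AffinePermutation {n : ℕ} .{{_ : NonZero n}} {w : ℤ → ℤ} (ap : IsAffinePerm n w) where
  open IsAffinePerm ap

  w-injective : ∀ {s t} → w s ≡ w t → s ≡ t
  w-injective = proj₁ bij

  w⁻¹ : ℤ → ℤ
  w⁻¹ x = proj₁ (proj₂ bij x)

  w∘w⁻¹ : ∀ x → w (w⁻¹ x) ≡ x
  w∘w⁻¹ x = proj₂ (proj₂ bij x) refl

  w⁻¹∘w : ∀ t → w⁻¹ (w t) ≡ t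
  w⁻¹∘w t = w-injective (w∘w⁻¹ (w t))

  w-+* : ∀ t q → w (t + q * + n) ≡ w t + q * + n
  w-+* = periodic-* {n} {w} periodic

  w⁻¹[x+n]≡ : ∀ x → w⁻¹ (x + + n) ≡ w⁻¹ x + + n
  w⁻¹[x+n]≡ x = w-injective (begin
    w (w⁻¹ (x + + n))   ≡⟨ w∘w⁻¹ (x + + n) ⟩
    x + + n             ≡⟨ cong (λ y → y + + n) (w∘w⁻¹ x) ⟨
    w (w⁻¹ x) + + n     ≡⟨ periodic (w⁻¹ x) ⟨
    w (w⁻¹ x + + n)     ∎)
    where open ≡-Reasoning

  w⁻¹[x-n]≡ : ∀ x → w⁻¹ (x - + n) ≡ w⁻¹ x - + n
  w⁻¹[x-n]≡ x = begin
    w⁻¹ (x - + n)                ≡⟨ add-sub (w⁻¹ (x - + n)) (+ n) ⟨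
    w⁻¹ (x - + n) + + n - + n    ≡⟨ cong (λ y → y - + n) (w⁻¹[x+n]≡ (x - + n)) ⟨
    w⁻¹ (x - + n + + n) - + n    ≡⟨ cong (λ y → w⁻¹ y - + n) (sub-add x (+ n)) ⟩
    w⁻¹ x - + n                  ∎
    where
    open ≡-Reasoning
    add-sub : ∀ x y → x + y - y ≡ x
    add-sub = solve-∀
    sub-add : ∀ x y → x - y + y ≡ x
    sub-add = solve-∀

  w-from-window : ∀ t → ∃[ r ] r ℕ.< n × ∃[ q ] t ≡ + suc r + q * + n × w t ≡ w (+ suc r) + q * + n
  w-from-window t with divMod-from-1 n t
  ... | r , r<n , q , t≡ = r , r<n , q , t≡ , trans (cong w t≡) (w-+* (+ suc r) q)

  translate-to-window : ∀ {i j c} → i < j → w i - w j ≡ c →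
                        ∃[ s ] s ℕ.< n × ∃[ i' ] i' < + suc s × w i' ≡ w (+ suc s) + c
  translate-to-window {i} {j} {c} i<j wi-wj≡c with w-from-window j
  ... | s , s<n , q , j≡ , wj≡ = s , s<n , i' , i'<1+s , wi'≡
    where
    open ≡-Reasoning
    i' : ℤ
    i' = i + - q * + n
    i'<1+s : i' < + suc s
    i'<1+s = subst (i' <_) (trans (cong (λ y → y + - q * + n) j≡) (cancel (+ suc s) q (+ n)))
                           (ℤP.+-monoˡ-< (- q * + n) i<j)
      where
      cancel : ∀ x q n → x + q * n + - q * n ≡ x
      cancel = solve-∀
    wi'≡ : w i' ≡ w (+ suc s) + c
    wi'≡ = begin
      w i'                                ≡⟨ add-sub (w i') (q * + n) ⟨
      w i' + q * + n - q * + n            ≡⟨ cong (λ y → y - q * + n) (w-+* i' q) ⟨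
      w (i' + q * + n) - q * + n          ≡⟨ cong (λ y → w y - q * + n) (sub-add i q (+ n)) ⟩
      w i - q * + n                       ≡⟨ cong (λ y → y - q * + n) (split (w i) (w j)) ⟩
      w j + (w i - w j) - q * + n         ≡⟨ cong₂ (λ y z → y + z - q * + n) wj≡ wi-wj≡c ⟩
      w (+ suc s) + q * + n + c - q * + n ≡⟨ cancel (w (+ suc s)) (q * + n) c ⟩
      w (+ suc s) + c                     ∎
      where
      add-sub : ∀ x y → x + y - y ≡ x
      add-sub = solve-∀
      sub-add : ∀ x q n → x + - q * n + q * n ≡ x
      sub-add = solve-∀
      split : ∀ x y → x ≡ y + (x - y)
      split = solve-∀
      cancel : ∀ x y z → x + y + z - y ≡ x + z
      cancel = solve-∀

  ∈-wList⁺ : ∀ {r} → r ℕ.< n → w (+ suc r) ∈ wList n w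
  ∈-wList⁺ r<n = ∈-map⁺ (λ r → w (+ suc r)) (∈-upTo⁺ r<n)

  ∈-wList⁻ : ∀ {x} → x ∈ wList n w → ∃[ r ] r ℕ.< n × x ≡ w (+ suc r)
  ∈-wList⁻ x∈ with ∈-map⁻ (λ r → w (+ suc r)) x∈
  ... | r , r∈ , x≡ = r , ∈-upTo⁻ r∈ , x≡

  wList-unique : Unique (wList n w)
  wList-unique = map⁺ (λ eq → ℕP.suc-injective (ℤP.+-injective (w-injective eq))) (upTo⁺ n)

dominant-< : ∀ {n w} → Dominant n w → ∀ {r s} → r ℕ.< s → s ℕ.< n → w (+ suc r) < w (+ suc s)
dominant-< {w = w} dom {r} {suc s} r<1+s 1+s<n with ℕP.m<1+n⇒m<n∨m≡n r<1+s
... | inj₁ r<s  = ℤP.<-trans (dominant-< {w = w} dom r<s (ℕP.<-trans (ℕP.n<1+n s) 1+s<n)) (dom s 1+s<n)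
... | inj₂ refl = dom r 1+s<n

module FilterToSommers {m n : ℕ} .{{_ : NonZero n}} {w : ℤ → ℤ}
                       (ap : IsAffinePerm n w) (dom : Dominant n w)
                       {𝔟 : Subset²} (𝔟-filter : IsFilter m n 𝔟)
                       (w-∈-nSet : ∀ {r} → r ℕ.< n → nSet m n 𝔟 (w (+ suc r))) where
  open AffinePermutation ap
  open IsFilter 𝔟-filter

  IsLevel : ℤ → Set
  IsLevel x = ∃[ i ] ∃[ j ] 𝔟 i j × level m n i j ≡ x

  w-isLevel : ∀ {r} → r ℕ.< n → IsLevel (w (+ suc r))
  w-isLevel r<n with w-∈-nSet r<n
  ... | i , (j , 𝔟ij , ℓ≡) , _ = i , j , 𝔟ij , ℓ≡

  isLevel-+m : ∀ {x} → IsLevel x → IsLevel (x + + m)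
  isLevel-+m (i , j , 𝔟ij , ℓ≡x) = i + + 1 , j , upward i j _ j 𝔟ij (ℤP.i≤i+j i (+ 1)) ℤP.≤-refl ,
    trans (level-+ⁱ m n i j (+ 1)) (cong₂ _+_ ℓ≡x (ℤP.*-identityˡ (+ m)))

  isLevel⇒positive : ∀ t → IsLevel (w t) → + 1 ≤ t
  isLevel⇒positive t (i , j , 𝔟ij , ℓ≡wt) with w-from-window t
  ... | r , _ , + a , t≡ , _ = subst (+ 1 ≤_) (sym t≡) (1≤1+r+an r a n)
  ... | r , r<n , -[1+ a ] , _ , wt≡ with w-∈-nSet r<n
  ... | i₁ , (j₁ , _ , ℓ₁≡X) , minimal =
    ⊥-elim (ℤP.<⇒≱ (i+[-1-a]n<i X a n) (subst (X ≤_) ℓ≡ (minimal (j₁ + q) 𝔟₁)))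
    where
    X : ℤ
    X = w (+ suc r)
    q : ℤ
    q = -[1+ a ]
    ℓ≡ : level m n i₁ (j₁ + q) ≡ X + q * + n
    ℓ≡ = trans (level-+ʲ m n i₁ j₁ q) (cong (λ y → y + q * + n) ℓ₁≡X)
    𝔟₁ : 𝔟 i₁ (j₁ + q)
    𝔟₁ = levelClosed i j i₁ (j₁ + q) 𝔟ij (trans ℓ≡wt (trans wt≡ (sym ℓ≡)))

  inverseInSommers : InverseInSommers m w
  inverseInSommers i j i<j wi-wj≡m with translate-to-window i<j wi-wj≡m
  ... | s , s<n , i' , i'<1+s , wi'≡
      with 1≤t<1+s⇒t≡1+r (isLevel⇒positive i' (subst IsLevel (sym wi'≡) (isLevel-+m (w-isLevel s<n))))
                          i'<1+s
  ... | r , r<s , refl = ℤP.<⇒≱ (dominant-< {w = w} dom r<s s<n)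
                           (subst (w (+ suc s) ≤_) (sym wi'≡) (ℤP.i≤i+j (w (+ suc s)) (+ m)))

module SommersToFilter {m n : ℕ} .{{_ : NonZero m}} .{{_ : NonZero n}} (cop : Coprime m n)
                       {w : ℤ → ℤ} (ap : IsAffinePerm n w) (sommers : InverseInSommers m w) where
  open AffinePermutation ap
  open IsAffinePerm ap using (sumCond)
  open Extrema ℤP.≤-totalOrder using (min; max; min≤xs; xs≤max; min≤⊤; ⊥≤max)

  PositivePreimage : ℤ → Set
  PositivePreimage x = + 1 ≤ w⁻¹ x

  positivePreimage? : Decidable PositivePreimage
  positivePreimage? x = + 1 ℤP.≤? w⁻¹ x

  positivePreimage-+n : ∀ x → PositivePreimage x → PositivePreimage (x + + n)
  positivePreimage-+n x 1≤ = subst (+ 1 ≤_) (sym (w⁻¹[x+n]≡ x)) (ℤP.≤-trans 1≤ (ℤP.i≤i+j _ (+ n)))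

  positivePreimage-+m : ∀ x → PositivePreimage x → PositivePreimage (x + + m)
  positivePreimage-+m x 1≤ = ℤP.≤-trans 1≤ (ℤP.≮⇒≥ λ w⁻¹[x+m]<w⁻¹x →
    sommers _ _ w⁻¹[x+m]<w⁻¹x (trans (cong₂ _-_ (w∘w⁻¹ (x + + m)) (w∘w⁻¹ x)) (x+m-x≡m x (+ m))))
    where
    x+m-x≡m : ∀ x m → x + m - x ≡ m
    x+m-x≡m = solve-∀

  L B : ℤ
  L = min 0ℤ (wList n w)
  B = max 0ℤ (wList n w)

  L≤w : ∀ {r} → r ℕ.< n → L ≤ w (+ suc r)
  L≤w r<n = All.lookup (min≤xs 0ℤ (wList n w)) (∈-wList⁺ r<n)

  w≤B : ∀ {r} → r ℕ.< n → w (+ suc r) ≤ B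
  w≤B r<n = All.lookup (xs≤max 0ℤ (wList n w)) (∈-wList⁺ r<n)

  classify : ∀ x → (PositivePreimage x × L ≤ x) ⊎ (¬ PositivePreimage x × x < B)
  classify x with w-from-window (w⁻¹ x)
  ... | r , r<n , + a , t≡ , wt≡ = inj₁ (subst (+ 1 ≤_) (sym t≡) (1≤1+r+an r a n) ,
        ℤP.≤-trans (L≤w r<n) (subst (w (+ suc r) ≤_) (sym (trans (sym (w∘w⁻¹ x)) wt≡)) (i≤i+an _ a n)))
  ... | r , r<n , -[1+ a ] , t≡ , wt≡ = inj₂ (ℤP.<⇒≱ (subst (_< + 1) (sym t≡) (1+r-[1+a]n<1 a r<n)) ,
        ℤP.<-≤-trans (subst (_< w (+ suc r)) (sym (trans (sym (w∘w⁻¹ x)) wt≡)) (i+[-1-a]n<i _ a n)) (w≤B r<n))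

  ¬positivePreimage-below : ∀ x → x < L → ¬ PositivePreimage x
  ¬positivePreimage-below x x<L with classify x
  ... | inj₁ (_ , L≤x) = ⊥-elim (ℤP.<⇒≱ x<L L≤x)
  ... | inj₂ (¬Px , _) = ¬Px

  positivePreimage-above : ∀ x → B ≤ x → PositivePreimage x
  positivePreimage-above x B≤x with classify x
  ... | inj₁ (Px , _)  = Px
  ... | inj₂ (_ , x<B) = ⊥-elim (ℤP.<⇒≱ x<B B≤x)

  ¬positivePreimage[x-n]⇒w⁻¹x<1+n : ∀ x → ¬ PositivePreimage (x - + n) → w⁻¹ x < + suc n
  ¬positivePreimage[x-n]⇒w⁻¹x<1+n x ¬1≤t-n = subst (_< + suc n) (sub-add (w⁻¹ x) (+ n))
    (ℤP.+-monoˡ-< (+ n) (subst (_< + 1) (w⁻¹[x-n]≡ x) (ℤP.≰⇒> ¬1≤t-n)))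
    where
    sub-add : ∀ x y → x - y + y ≡ x
    sub-add = solve-∀

  open LevelFilter m n positivePreimage? positivePreimage-+m positivePreimage-+n public

  isGenerator⇔∈wList : ∀ x → Gⁿ.IsGenerator x ⇔ x ∈ wList n w
  isGenerator⇔∈wList x = mk⇔ ⇒∈ ∈⇒
    where
    ⇒∈ : Gⁿ.IsGenerator x → x ∈ wList n w
    ⇒∈ (1≤t , ¬1≤t-n) with 1≤t<1+s⇒t≡1+r 1≤t (¬positivePreimage[x-n]⇒w⁻¹x<1+n x ¬1≤t-n)
    ... | r , r<n , t≡ = subst (_∈ wList n w) (trans (cong w (sym t≡)) (w∘w⁻¹ x)) (∈-wList⁺ r<n)
    ∈⇒ : x ∈ wList n w → Gⁿ.IsGenerator x
    ∈⇒ x∈ with ∈-wList⁻ x∈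
    ... | r , r<n , refl = subst (+ 1 ≤_) (sym (w⁻¹∘w _)) (ℤ.+≤+ (ℕ.s≤s ℕ.z≤n)) , λ 1≤ →
      ℤP.<⇒≱ (1+r-[1+a]n<1 0 r<n)
        (subst (+ 1 ≤_) (trans (w⁻¹[x-n]≡ _) (trans (cong (λ t → t - + n) (w⁻¹∘w _)) (x-n≡ (+ suc r) (+ n)))) 1≤)
      where
      x-n≡ : ∀ x n → x - n ≡ x + -[1+ 0 ] * n
      x-n≡ = solve-∀

  surjective : ∀ x → ∃[ i ] ∃[ j ] level m n i j ≡ x
  surjective = coprime⇒level-surjective cop

  nSet⇔∈wList : ∀ x → nSet m n levelSet x ⇔ x ∈ wList n w
  nSet⇔∈wList x = isGenerator⇔∈wList x ⇔-∘ mk⇔ nSet⇒isGenerator (isGenerator⇒nSet surjective)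

  L≤B : L ≤ B
  L≤B = ℤP.≤-trans (min≤⊤ 0ℤ (wList n w)) (⊥≤max 0ℤ (wList n w))

  -- W = (B - L) m n is a common multiple of m and n reaching below L, so both generator
  -- sums count the points of P in the same window [B - W, B).
  d : ℕ
  d = proj₁ (≤⇒≡+ L≤B)

  W : ℕ
  W = d ℕ.* (m ℕ.* n)

  B-W≤L : B - + W ≤ L
  B-W≤L = subst (B - + W ≤_) B-d≡L
    (ℤP.+-monoʳ-≤ B (ℤP.neg-mono-≤ (ℤ.+≤+ (ℕP.m≤m*n d (m ℕ.* n) {{ℕP.m*n≢0 m n}}))))
    where
    regroup : ∀ L d → L + d - d ≡ L
    regroup = solve-∀
    B-d≡L : B - + d ≡ L
    B-d≡L = trans (cong (λ x → x - + d) (proj₂ (≤⇒≡+ L≤B))) (regroup L (+ d))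

  W≡dnm : W ≡ d ℕ.* n ℕ.* m
  W≡dnm = trans (cong (d ℕ.*_) (ℕP.*-comm m n)) (sym (ℕP.*-assoc d n m))

  #below : ℕ → ℕ
  #below V = windowSum (indicator positivePreimage?) (B - + V) V

  module Bⁿ = Gⁿ.Bounded L B ¬positivePreimage-below positivePreimage-above (d ℕ.* m)
                (subst (λ V → B - + V ≤ L) (sym (ℕP.*-assoc d m n)) B-W≤L)
  module Bᵐ = Gᵐ.Bounded L B ¬positivePreimage-below positivePreimage-above (d ℕ.* n)
                (subst (λ V → B - + V ≤ L) W≡dnm B-W≤L)

  B-#below≡1 : B - + #below W ≡ + 1
  B-#below≡1 = affine-cancel n (begin
    + n * (B - + #below W) + + (n C 2)        ≡⟨ cong (λ V → + n * (B - + #below V) + + (n C 2)) (ℕP.*-assoc d m n) ⟨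
    + n * (B - + #below (d ℕ.* m ℕ.* n)) + + (n C 2) ≡⟨ Bⁿ.sum-generators ⟨
    sumℤ Bⁿ.generators                        ≡⟨ unique∧set⇒sumℤ≡ Bⁿ.generators-unique wList-unique
                                                   (λ x → isGenerator⇔∈wList x ⇔-∘ Bⁿ.∈-generators⇔ x) ⟩
    sumℤ (wList n w)                          ≡⟨ sumCond ⟩
    tri n                                     ≡⟨ tri-unfold n ⟩
    + n * + 1 + + (n C 2)                     ∎)
    where open ≡-Reasoning

  sum-mSet : sumℤ Bᵐ.generators ≡ tri m
  sum-mSet = begin
    sumℤ Bᵐ.generators                                ≡⟨ Bᵐ.sum-generators ⟩
    + m * (B - + #below (d ℕ.* n ℕ.* m)) + + (m C 2)  ≡⟨ cong (λ V → + m * (B - + #below V) + + (m C 2)) W≡dnm ⟨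
    + m * (B - + #below W) + + (m C 2)                ≡⟨ cong (λ x → + m * x + + (m C 2)) B-#below≡1 ⟩
    + m * + 1 + + (m C 2)                             ≡⟨ tri-unfold m ⟨
    tri m                                             ∎
    where open ≡-Reasoning

  levelSet-balanced : IsBalanced m n levelSet
  levelSet-balanced = record
    { filter = levelSet-isFilter surjective {w (+ 1)} {w (+ 0)}
                 (subst (+ 1 ≤_) (sym (w⁻¹∘w (+ 1))) ℤP.≤-refl)
                 (λ 1≤ → ℤP.<⇒≱ (ℤ.+<+ ℕ.z<s) (subst (+ 1 ≤_) (w⁻¹∘w (+ 0)) 1≤))
    ; mSum   = Bᵐ.generators , Bᵐ.generators-unique ,
               (λ x → mk⇔ (isGenerator⇒mSet surjective) mSet⇒isGenerator ⇔-∘ Bᵐ.∈-generators⇔ x) , sum-mSet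
    ; nSum   = wList n w , wList-unique , (λ x → ⇔-sym (nSet⇔∈wList x)) , sumCond
    }

theorem6p6 : (m n : ℕ) → 0 ℕ.< m → 0 ℕ.< n → Coprime m n →
    (w : ℤ → ℤ) → IsAffinePerm n w → Dominant n w →
    InverseInSommers m w ⇔
      Σ Subset² (λ 𝔟 → IsBalanced m n 𝔟 × (∀ x → nSet m n 𝔟 x ⇔ (x ∈ wList n w)))
theorem6p6 m n 0<m 0<n cop w ap dom = mk⇔ sommers⇒balanced balanced⇒sommers
  where
  instance
    m≢0 : NonZero m
    m≢0 = ℕ.>-nonZero 0<m
    n≢0 : NonZero n
    n≢0 = ℕ.>-nonZero 0<n

  BalancedFilterForW : Set₁
  BalancedFilterForW = Σ Subset² (λ 𝔟 → IsBalanced m n 𝔟 × (∀ x → nSet m n 𝔟 x ⇔ (x ∈ wList n w)))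

  sommers⇒balanced : InverseInSommers m w → BalancedFilterForW
  sommers⇒balanced sommers = levelSet , levelSet-balanced , nSet⇔∈wList
    where open SommersToFilter cop ap sommers

  balanced⇒sommers : BalancedFilterForW → InverseInSommers m w
  balanced⇒sommers (𝔟 , 𝔟-balanced , nSet⇔∈wList) =
    FilterToSommers.inverseInSommers ap dom (IsBalanced.filter 𝔟-balanced)
      (λ r<n → Equivalence.from (nSet⇔∈wList _) (AffinePermutation.∈-wList⁺ ap r<n))
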